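{- Let $S$ be a numerical semigroup with $S\neq\mathbb{N}$. Then the set of ideal extensions of $S$ equals $\{S\cup A\mid A \text{ is an } \mathrm{i}(S)\text{ -pertinent set}\}$.
   Context: A numerical semigroup is a subset $S\subseteq\mathbb{N}$ containing $0$, closed under addition, with finite complement in $\mathbb{N}$. An ideal of a numerical semigroup $\Delta$ is a nonempty $I\subseteq\Delta$ with $I+\Delta\subseteq I$; a numerical semigroup $\Delta$ is an ideal extension of $S$ if $S\setminus\{0\}$ is an ideal of $\Delta$. $\mathrm{PF}(S)$ is the set of integers $x\notin S$ with $x+s\in S$ for all $s\in S\setminus\{0\}$. A set $A$ is $\mathrm{i}(S)$-pertinent if $A\subseteq\mathrm{PF}(S)$ and, whenever $\{a,b\}\subseteq A$ and $a+b\in\mathrm{PF}(S)$, then $a+b\in A$. -}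

module Defs where

open import Data.Nat using (ℕ; zero; suc; _+_)
open import Data.Bool using (Bool; true; false; _∨_)
open import Data.List using (List)
open import Data.List.Membership.Propositional using () renaming (_∈_ to _∈ₗ_)
open import Data.Product using (Σ; _×_; ∃)
open import Relation.Binary.PropositionalEquality using (_≡_; _≢_)

SubsetN : Set
SubsetN = ℕ → Bool

infix 4 _∈_ _∉_
_∈_ : ℕ → SubsetN → Set
x ∈ X = X x ≡ true

_∉_ : ℕ → SubsetN → Set
x ∉ X = X x ≡ false

_∪_ : SubsetN → SubsetN → SubsetN
(X ∪ Y) n = X n ∨ Y n

nonzeroPart : SubsetN → SubsetN
nonzeroPart X zero    = false
nonzeroPart X (suc n) = X (suc n)

record IsNumericalSemigroup (S : SubsetN) : Set where
  field
    zero∈      : 0 ∈ S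
    +-closed   : ∀ x y → x ∈ S → y ∈ S → (x + y) ∈ S
    finiteCompl : Σ (List ℕ) λ L → ∀ n → n ∉ S → n ∈ₗ L

record IsIdeal (I Δ : SubsetN) : Set where
  field
    nonempty : ∃ λ x → x ∈ I
    sub      : ∀ x → x ∈ I → x ∈ Δ
    absorb   : ∀ x d → x ∈ I → d ∈ Δ → (x + d) ∈ I

IsIdealExtension : SubsetN → SubsetN → Set
IsIdealExtension S Δ = IsNumericalSemigroup Δ × IsIdeal (nonzeroPart S) Δ

PF : SubsetN → ℕ → Set
PF S x = x ∉ S × (∀ s → s ∈ S → s ≢ 0 → (x + s) ∈ S)

IsPertinent : SubsetN → SubsetN → Set
IsPertinent S A =
  (∀ x → x ∈ A → PF S x) ×
  (∀ a b → a ∈ A → b ∈ A → PF S (a + b) → (a + b) ∈ A)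

{-# OPTIONS --safe #-}
-- An ideal extension Δ of S contains S (its nonzero part is an ideal of Δ, and 0 ∈ Δ),
-- so Δ = S ∪ (Δ ∖ S). An element x of Δ ∖ S satisfies s + x ∈ S∖{0} for every nonzero
-- s ∈ S, i.e. x ∈ PF(S), and additive closure of Δ makes Δ ∖ S pertinent. Conversely, for a
-- pertinent A the sums S+A and A+A stay in S ∪ A: a pseudo-Frobenius number moves nonzero
-- elements of S into S, and a sum of two of them is either in S or again pseudo-Frobenius.
module Submission where

open import Defs
open import Data.Nat using (ℕ; zero; suc; _+_; _≤_)
open import Data.Nat.Properties
  using (+-comm; +-assoc; m≤m+n; m≤n+m; ≤-trans; n≮n; m+n≡0⇒m≡0; m+n≡0⇒n≡0)
open import Data.Bool using (true; false; _∧_; not)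
open import Data.Bool.Properties using (∨-zeroʳ; ∨-conicalˡ)
open import Data.List using (List; _∷_)
open import Data.Nat.ListAction using (sum)
open import Data.List.Relation.Unary.Any using (here; there)
open import Data.List.Membership.Propositional using () renaming (_∈_ to _∈ₗ_)
open import Data.Product using (Σ; _×_; _,_; proj₁; proj₂; ∃)
open import Data.Sum using (_⊎_; inj₁; inj₂)
open import Data.Empty using (⊥-elim)
open import Relation.Nullary using (¬_)
open import Relation.Binary.PropositionalEquality
  using (_≡_; _≢_; _≗_; refl; sym; trans; subst)
open import Function.Base using (_∘_)
open import Function.Bundles using (_⇔_; mk⇔)

private
  variable
    m n : ℕ

_⊆_ : SubsetN → SubsetN → Set
X ⊆ Y = ∀ {n} → n ∈ X → n ∈ Y

_∖_ : SubsetN → SubsetN → SubsetN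
(X ∖ Y) n = X n ∧ not (Y n)

≗-sym : {X Y : SubsetN} → X ≗ Y → Y ≗ X
≗-sym X≗Y n = sym (X≗Y n)

∈-resp-≗ : {X Y : SubsetN} → X ≗ Y → n ∈ X → n ∈ Y
∈-resp-≗ {n} X≗Y n∈X = trans (sym (X≗Y n)) n∈X

∉-resp-≗ : {X Y : SubsetN} → X ≗ Y → n ∉ X → n ∉ Y
∉-resp-≗ {n} X≗Y n∉X = trans (sym (X≗Y n)) n∉X

∈-∪⁺ˡ : (X Y : SubsetN) → n ∈ X → n ∈ (X ∪ Y)
∈-∪⁺ˡ X Y n∈X rewrite n∈X = refl

∈-∪⁺ʳ : (X Y : SubsetN) → n ∈ Y → n ∈ (X ∪ Y)
∈-∪⁺ʳ {n} X Y n∈Y rewrite n∈Y = ∨-zeroʳ (X n)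

∈-∪⁻ : (X Y : SubsetN) → n ∈ (X ∪ Y) → n ∈ X ⊎ n ∈ Y
∈-∪⁻ {n} X Y n∈X∪Y with X n
... | true  = inj₁ refl
... | false = inj₂ n∈X∪Y

∉-∪⁻ˡ : (X Y : SubsetN) → n ∉ (X ∪ Y) → n ∉ X
∉-∪⁻ˡ {n} X Y = ∨-conicalˡ (X n) (Y n)

∈-∖⁺ : (X Y : SubsetN) → n ∈ X → n ∉ Y → n ∈ (X ∖ Y)
∈-∖⁺ X Y n∈X n∉Y rewrite n∈X | n∉Y = refl

∈-∖⁻ : (X Y : SubsetN) → n ∈ (X ∖ Y) → n ∈ X × n ∉ Y
∈-∖⁻ {n} X Y n∈X∖Y with X n | Y n
... | true | false = refl , refl

⊆⇒≗-∪-∖ : (X Y : SubsetN) → X ⊆ Y → Y ≗ X ∪ (Y ∖ X)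
⊆⇒≗-∪-∖ X Y X⊆Y n with X n in n∈X
... | true  = X⊆Y n∈X
... | false with Y n
...   | true  = refl
...   | false = refl

∈-nonzeroPart⁺ : (X : SubsetN) → n ∈ X → n ≢ 0 → n ∈ nonzeroPart X
∈-nonzeroPart⁺ {zero}  X _   n≢0 = ⊥-elim (n≢0 refl)
∈-nonzeroPart⁺ {suc n} X n∈X _   = n∈X

∈-nonzeroPart⁻ : (X : SubsetN) (n : ℕ) → n ∈ nonzeroPart X → n ∈ X × n ≢ 0
∈-nonzeroPart⁻ X (suc n) n∈X = n∈X , λ ()

∈⇒≤sum : ∀ {xs : List ℕ} → n ∈ₗ xs → n ≤ sum xs
∈⇒≤sum {n} {_ ∷ xs} (here refl)  = m≤m+n n (sum xs)
∈⇒≤sum {_} {x ∷ xs} (there n∈xs) = ≤-trans (∈⇒≤sum n∈xs) (m≤n+m (sum xs) x)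

suc-sum-∉ : (xs : List ℕ) → ¬ (suc (sum xs) ∈ₗ xs)
suc-sum-∉ xs p = n≮n (sum xs) (∈⇒≤sum p)

isNumericalSemigroup-resp-≗ : {X Y : SubsetN} → X ≗ Y →
                              IsNumericalSemigroup X → IsNumericalSemigroup Y
isNumericalSemigroup-resp-≗ X≗Y NS = record
  { zero∈       = ∈-resp-≗ X≗Y zero∈
  ; +-closed    = λ x y x∈Y y∈Y →
      ∈-resp-≗ X≗Y (+-closed x y (∈-resp-≗ (≗-sym X≗Y) x∈Y) (∈-resp-≗ (≗-sym X≗Y) y∈Y))
  ; finiteCompl = proj₁ finiteCompl , λ n n∉Y → proj₂ finiteCompl n (∉-resp-≗ (≗-sym X≗Y) n∉Y)
  }
  where open IsNumericalSemigroup NS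

isIdeal-respʳ-≗ : {I Δ Δ′ : SubsetN} → Δ ≗ Δ′ → IsIdeal I Δ → IsIdeal I Δ′
isIdeal-respʳ-≗ Δ≗Δ′ ideal = record
  { nonempty = nonempty
  ; sub      = λ x x∈I → ∈-resp-≗ Δ≗Δ′ (sub x x∈I)
  ; absorb   = λ x d x∈I d∈Δ′ → absorb x d x∈I (∈-resp-≗ (≗-sym Δ≗Δ′) d∈Δ′)
  }
  where open IsIdeal ideal

∃-nonzero-element : (S : SubsetN) → IsNumericalSemigroup S → ∃ λ n → n ∈ nonzeroPart S
∃-nonzero-element S NS = suc (sum gaps) , suc-sum-gaps∈S
  where
  open IsNumericalSemigroup NS
  gaps : List ℕ
  gaps = proj₁ finiteCompl
  suc-sum-gaps∈S : suc (sum gaps) ∈ S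
  suc-sum-gaps∈S with S (suc (sum gaps)) in e
  ... | true  = refl
  ... | false = ⊥-elim (suc-sum-∉ gaps (proj₂ finiteCompl _ e))

PF-+ˡ : (S : SubsetN) → PF S n → m ∈ S → m ≢ 0 → m + n ∈ S
PF-+ˡ {n} {m} S (_ , n+) m∈S m≢0 = subst (_∈ S) (+-comm n m) (n+ m m∈S m≢0)

PF-+-PF : (S : SubsetN) → PF S m → PF S n → m + n ∉ S → PF S (m + n)
PF-+-PF {m} {n} S (_ , m+) (_ , n+) m+n∉S = m+n∉S , λ s s∈S s≢0 →
  subst (_∈ S) (sym (+-assoc m n s)) (m+ (n + s) (n+ s s∈S s≢0) (s≢0 ∘ m+n≡0⇒n≡0 n))

module _ (S Δ : SubsetN) (ext : IsIdealExtension S Δ) where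
  open IsNumericalSemigroup (proj₁ ext)
  open IsIdeal (proj₂ ext)

  idealExtension-⊇ : S ⊆ Δ
  idealExtension-⊇ {zero}  _   = zero∈
  idealExtension-⊇ {suc n} n∈S = sub (suc n) n∈S

  idealExtension-∖-PF : n ∈ Δ → n ∉ S → PF S n
  idealExtension-∖-PF {n} n∈Δ n∉S = n∉S , λ s s∈S s≢0 →
    subst (_∈ S) (+-comm s n)
      (proj₁ (∈-nonzeroPart⁻ S (s + n) (absorb s n (∈-nonzeroPart⁺ S s∈S s≢0) n∈Δ)))

  idealExtension-∖-pertinent : IsPertinent S (Δ ∖ S)
  idealExtension-∖-pertinent =
    (λ x x∈Δ∖S → let x∈Δ , x∉S = ∈-∖⁻ Δ S x∈Δ∖S in idealExtension-∖-PF x∈Δ x∉S) ,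
    λ a b a∈Δ∖S b∈Δ∖S PF[a+b] →
      ∈-∖⁺ Δ S (+-closed a b (proj₁ (∈-∖⁻ Δ S a∈Δ∖S)) (proj₁ (∈-∖⁻ Δ S b∈Δ∖S))) (proj₁ PF[a+b])

module _ (S A : SubsetN) (NS : IsNumericalSemigroup S) where
  open IsNumericalSemigroup NS

  S+A⊆S∪A : (∀ x → x ∈ A → PF S x) → m ∈ S → n ∈ A → m + n ∈ (S ∪ A)
  S+A⊆S∪A {zero}  _    _   n∈A = ∈-∪⁺ʳ S A n∈A
  S+A⊆S∪A {suc m} A⊆PF m∈S n∈A = ∈-∪⁺ˡ S A (PF-+ˡ S (A⊆PF _ n∈A) m∈S λ ())

  A+A⊆S∪A : IsPertinent S A → m ∈ A → n ∈ A → m + n ∈ (S ∪ A)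
  A+A⊆S∪A {m} {n} (A⊆PF , A-closed) m∈A n∈A with S (m + n) in m+n∈S
  ... | true  = refl
  ... | false = A-closed m n m∈A n∈A (PF-+-PF S (A⊆PF m m∈A) (A⊆PF n n∈A) m+n∈S)

  ∪-pertinent-+-closed : IsPertinent S A → m ∈ (S ∪ A) → n ∈ (S ∪ A) → m + n ∈ (S ∪ A)
  ∪-pertinent-+-closed {m} {n} P m∈S∪A n∈S∪A with ∈-∪⁻ S A m∈S∪A | ∈-∪⁻ S A n∈S∪A
  ... | inj₁ m∈S | inj₁ n∈S = ∈-∪⁺ˡ S A (+-closed m n m∈S n∈S)
  ... | inj₁ m∈S | inj₂ n∈A = S+A⊆S∪A (proj₁ P) m∈S n∈A
  ... | inj₂ m∈A | inj₁ n∈S = subst (_∈ (S ∪ A)) (+-comm n m) (S+A⊆S∪A (proj₁ P) n∈S m∈A)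
  ... | inj₂ m∈A | inj₂ n∈A = A+A⊆S∪A P m∈A n∈A

  ∪-pertinent-isNumericalSemigroup : IsPertinent S A → IsNumericalSemigroup (S ∪ A)
  ∪-pertinent-isNumericalSemigroup P = record
    { zero∈       = ∈-∪⁺ˡ S A zero∈
    ; +-closed    = λ _ _ → ∪-pertinent-+-closed P
    ; finiteCompl = proj₁ finiteCompl , λ n n∉S∪A → proj₂ finiteCompl n (∉-∪⁻ˡ S A n∉S∪A)
    }

  nonzero+∪⊆S : (∀ x → x ∈ A → PF S x) → m ∈ S → m ≢ 0 → n ∈ S ⊎ n ∈ A → m + n ∈ S
  nonzero+∪⊆S _    m∈S _   (inj₁ n∈S) = +-closed _ _ m∈S n∈S
  nonzero+∪⊆S A⊆PF m∈S m≢0 (inj₂ n∈A) = PF-+ˡ S (A⊆PF _ n∈A) m∈S m≢0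

  nonzeroPart-isIdeal-∪ : (∀ x → x ∈ A → PF S x) → IsIdeal (nonzeroPart S) (S ∪ A)
  nonzeroPart-isIdeal-∪ A⊆PF = record
    { nonempty = ∃-nonzero-element S NS
    ; sub      = λ x x∈S∖0 → ∈-∪⁺ˡ S A (proj₁ (∈-nonzeroPart⁻ S x x∈S∖0))
    ; absorb   = λ x d x∈S∖0 d∈S∪A → let x∈S , x≢0 = ∈-nonzeroPart⁻ S x x∈S∖0 in
        ∈-nonzeroPart⁺ S (nonzero+∪⊆S A⊆PF x∈S x≢0 (∈-∪⁻ S A d∈S∪A)) (x≢0 ∘ m+n≡0⇒m≡0 x)
    }

corollary9 : (S : SubsetN) → IsNumericalSemigroup S → ¬ (∀ n → n ∈ S) →
    (Δ : SubsetN) →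
    IsIdealExtension S Δ ⇔ Σ SubsetN (λ A → IsPertinent S A × (∀ n → Δ n ≡ (S ∪ A) n))
corollary9 S NS _ Δ = mk⇔
  (λ ext → Δ ∖ S , idealExtension-∖-pertinent S Δ ext , ⊆⇒≗-∪-∖ S Δ (idealExtension-⊇ S Δ ext))
  (λ (A , P , Δ≗S∪A) →
      isNumericalSemigroup-resp-≗ (≗-sym Δ≗S∪A) (∪-pertinent-isNumericalSemigroup S A NS P)
    , isIdeal-respʳ-≗ (≗-sym Δ≗S∪A) (nonzeroPart-isIdeal-∪ S A NS (proj₁ P)))
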